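{- Let $h_1\ge\dots\ge h_n>0$ be integers. If a $\mathrm{LS}(h_1\dots h_n)$ exists, then an $m\mathrm{RP}(h_1\dots h_n)$ exists for all $m\ge3$.
   Context: Let $N=\sum h_i$. A latin square of order $N$ is an $N\times N$ array on $N$ symbols with each symbol once in each row and column; a subsquare is an $h\times h$ subarray that is a latin square of order $h$; subsquares are disjoint if they share no row, column or symbol; a $\mathrm{LS}(h_1\dots h_n)$ is a latin square of order $N$ with pairwise disjoint subsquares of orders $h_1,\dots,h_n$. An $m$-dimensional latin hypercube of order $N$ is a function $L:[N]^m\to[N]$ such that whenever two index tuples differ in exactly one coordinate their values differ. A subhypercube of order $h$ is the restriction of $L$ to $T_1\times\dots\times T_m$ with $|T_j|=h$ which is itself a latin hypercube of order $h$; subhypercubes are disjoint if their index sets are disjoint in every coordinate and their symbol sets are disjoint. An $m\mathrm{RP}(h_1\dots h_n)$ is an $m$-dimensional latin hypercube of order $N$ with pairwise disjoint subhypercubes of orders $h_1,\dots,h_n$. -}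

module Defs where

open import Data.Nat using (ℕ; zero; suc; _+_; _≤_; _<_)
open import Data.Fin using (Fin; zero; suc)
open import Data.Product using (Σ; ∃; ∃-syntax; _×_; _,_)
open import Relation.Binary.PropositionalEquality using (_≡_; _≢_)
open import Relation.Nullary using (¬_)
open import Function.Definitions using (Injective)

sumF : (n : ℕ) → (Fin n → ℕ) → ℕ
sumF zero    h = 0
sumF (suc n) h = h zero + sumF n (λ i → h (suc i))

IsLatinSquare : (N : ℕ) → (Fin N → Fin N → Fin N) → Set
IsLatinSquare N L =
  (∀ r s → ∃[ c ] (L r c ≡ s × (∀ c′ → L r c′ ≡ s → c′ ≡ c))) ×
  (∀ c s → ∃[ r ] (L r c ≡ s × (∀ r′ → L r′ c ≡ s → r′ ≡ r)))

-- a subsquare of order h: rows R = im ρ, columns C = im κ (|R| = |C| = h),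
-- and the subarray is a latin square of order h on the symbol set im σ (size h)
record Subsquare (N : ℕ) (L : Fin N → Fin N → Fin N) (h : ℕ) : Set where
  field
    rows  : Fin h → Fin N
    cols  : Fin h → Fin N
    syms  : Fin h → Fin N
    rows-inj : Injective _≡_ _≡_ rows
    cols-inj : Injective _≡_ _≡_ cols
    syms-inj : Injective _≡_ _≡_ syms
    square   : Fin h → Fin h → Fin h
    square-latin : IsLatinSquare h square
    restrict : ∀ i j → L (rows i) (cols j) ≡ syms (square i j)

DisjointIm : ∀ {a b N} → (Fin a → Fin N) → (Fin b → Fin N) → Set
DisjointIm f g = ∀ i j → f i ≢ g j

DisjointSubsquares : ∀ {N L h h′} → Subsquare N L h → Subsquare N L h′ → Set
DisjointSubsquares S T =
  DisjointIm (Subsquare.rows S) (Subsquare.rows T) ×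
  DisjointIm (Subsquare.cols S) (Subsquare.cols T) ×
  DisjointIm (Subsquare.syms S) (Subsquare.syms T)

LS : (n : ℕ) → (Fin n → ℕ) → Set
LS n h =
  Σ (Fin (sumF n h) → Fin (sumF n h) → Fin (sumF n h)) λ L →
    IsLatinSquare (sumF n h) L ×
    Σ ((i : Fin n) → Subsquare (sumF n h) L (h i)) λ S →
      ∀ i j → i ≢ j → DisjointSubsquares (S i) (S j)

DifferInExactlyOne : ∀ {m N} → (Fin m → Fin N) → (Fin m → Fin N) → Set
DifferInExactlyOne {m} x y = ∃[ j ] (x j ≢ y j × (∀ k → k ≢ j → x k ≡ y k))

IsLatinHypercube : (m N : ℕ) → ((Fin m → Fin N) → Fin N) → Set
IsLatinHypercube m N L = ∀ x y → DifferInExactlyOne x y → L x ≢ L y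

-- a subhypercube of order h: index sets T_j = im (idx j) with |T_j| = h,
-- and the restriction is a latin hypercube of order h on the symbol set im syms
record Subhypercube (m N : ℕ) (L : (Fin m → Fin N) → Fin N) (h : ℕ) : Set where
  field
    idx  : Fin m → Fin h → Fin N
    syms : Fin h → Fin N
    idx-inj  : ∀ j → Injective _≡_ _≡_ (idx j)
    syms-inj : Injective _≡_ _≡_ syms
    cube       : (Fin m → Fin h) → Fin h
    cube-latin : IsLatinHypercube m h cube
    restrict   : ∀ x → L (λ j → idx j (x j)) ≡ syms (cube x)

DisjointSubhypercubes : ∀ {m N L h h′} →
  Subhypercube m N L h → Subhypercube m N L h′ → Set
DisjointSubhypercubes S T =
  (∀ j → DisjointIm (Subhypercube.idx S j) (Subhypercube.idx T j)) ×
  DisjointIm (Subhypercube.syms S) (Subhypercube.syms T)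

RP : (m n : ℕ) → (Fin n → ℕ) → Set
RP m n h =
  Σ ((Fin m → Fin (sumF n h)) → Fin (sumF n h)) λ L →
    IsLatinHypercube m (sumF n h) L ×
    Σ ((i : Fin n) → Subhypercube m (sumF n h) L (h i)) λ S →
      ∀ i j → i ≢ j → DisjointSubhypercubes (S i) (S j)

module Submission where

open import Defs
open import Data.Nat using (ℕ; _≤_; _<_; zero; suc)
open import Data.Fin using (Fin; zero; suc)
open import Data.Fin.Base using () renaming (_≤_ to _≤ꟳ_)
open import Data.Fin.Properties using (suc-injective)
open import Data.Vec.Functional using (head; tail)
open import Data.Product using (_×_; _,_; proj₁; proj₂)
open import Relation.Binary.PropositionalEquality
open import Function.Definitions using (Injective)
import Algebra.Definitions as AlgebraDefinitions

-- Let f and g be latin squares such that every subsquare of f, read with its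
-- symbols as rows, is a subsquare of g and vice versa; the row-conjugate of a
-- latin square is such a partner.  The alternating composition
--   H(x₀, …, xₘ) = g (f (g ( … , x₂), x₁), x₀)
-- is then an (m+1)-dimensional latin hypercube, since changing one coordinate
-- changes exactly one factor and each factor is cancellative; and restricted
-- to the rows and columns of a subsquare it is the alternating composition of
-- the two subsquares, hence a subhypercube.

open module Cancellation {X : Set} = AlgebraDefinitions {A = X} _≡_
  using (Cancellative)

alternate : {X : Set} (f g : X → X → X) (m : ℕ) → (Fin (suc m) → X) → X
alternate f g zero    x = head x
alternate f g (suc m) x = g (alternate g f m (tail x)) (head x)

alternate-cong : {X : Set} (f g : X → X → X) (m : ℕ) {x y : Fin (suc m) → X} →
  x ≗ y → alternate f g m x ≡ alternate f g m y
alternate-cong f g zero    x≗y = x≗y zero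
alternate-cong f g (suc m) x≗y =
  cong₂ g (alternate-cong g f m (λ k → x≗y (suc k))) (x≗y zero)

alternate-latin : {K : ℕ} {f g : Fin K → Fin K → Fin K} →
  Cancellative f → Cancellative g → ∀ m → IsLatinHypercube (suc m) K (alternate f g m)
alternate-latin _ _ zero x y (zero , x₀≢y₀ , _) = x₀≢y₀
alternate-latin {f = f} {g} _ (cancelˡ , _) (suc m) x y (zero , x₀≢y₀ , same) eq =
  x₀≢y₀ (cancelˡ _ _ _ (trans eq (cong (λ v → g v (head y)) (sym tails-equal))))
  where
  tails-equal : alternate g f m (tail x) ≡ alternate g f m (tail y)
  tails-equal = alternate-cong g f m (λ k → same (suc k) (λ ()))
alternate-latin {g = g} cf cg@(_ , cancelʳ) (suc m) x y (suc j , xⱼ≢yⱼ , same) eq =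
  alternate-latin cg cf m (tail x) (tail y)
    (j , xⱼ≢yⱼ , λ k k≢j → same (suc k) (λ e → k≢j (suc-injective e)))
    (cancelʳ _ _ _ (trans eq (cong (g _) (sym (same zero (λ ()))))))

module _ {N : ℕ} (L : Fin N → Fin N → Fin N) (latin : IsLatinSquare N L) where

  latinSquare-cancellative : Cancellative L
  latinSquare-cancellative = cancelˡ , cancelʳ
    where
    cancelˡ : ∀ r c c′ → L r c ≡ L r c′ → c ≡ c′
    cancelˡ r c c′ e with proj₁ latin r (L r c)
    ... | _ , _ , unique = trans (unique c refl) (sym (unique c′ (sym e)))
    cancelʳ : ∀ c r r′ → L r c ≡ L r′ c → r ≡ r′
    cancelʳ c r r′ e with proj₂ latin c (L r c)
    ... | _ , _ , unique = trans (unique r refl) (sym (unique r′ (sym e)))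

  -- rowConjugate s c is the row in which column c of L holds symbol s
  rowConjugate : Fin N → Fin N → Fin N
  rowConjugate s c = proj₁ (proj₂ latin c s)

  rowConjugate-spec : ∀ s c → L (rowConjugate s c) c ≡ s
  rowConjugate-spec s c = proj₁ (proj₂ (proj₂ latin c s))

  rowConjugate-unique : ∀ s c r → L r c ≡ s → r ≡ rowConjugate s c
  rowConjugate-unique s c = proj₂ (proj₂ (proj₂ latin c s))

  rowConjugate-cancellative : Cancellative rowConjugate
  rowConjugate-cancellative = cancelˡ , cancelʳ
    where
    cancelˡ : ∀ s c c′ → rowConjugate s c ≡ rowConjugate s c′ → c ≡ c′
    cancelˡ s c c′ e = proj₁ latinSquare-cancellative _ c c′ (begin
      L (rowConjugate s c) c   ≡⟨ rowConjugate-spec s c ⟩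
      s                        ≡⟨ sym (rowConjugate-spec s c′) ⟩
      L (rowConjugate s c′) c′ ≡⟨ cong (λ r → L r c′) (sym e) ⟩
      L (rowConjugate s c) c′  ∎)
      where open ≡-Reasoning
    cancelʳ : ∀ c s s′ → rowConjugate s c ≡ rowConjugate s′ c → s ≡ s′
    cancelʳ c s s′ e = begin
      s                        ≡⟨ sym (rowConjugate-spec s c) ⟩
      L (rowConjugate s c) c   ≡⟨ cong (λ r → L r c) e ⟩
      L (rowConjugate s′ c) c  ≡⟨ rowConjugate-spec s′ c ⟩
      s′                       ∎
      where open ≡-Reasoning

record Block {N : ℕ} (f : Fin N → Fin N → Fin N) (h : ℕ) : Set where
  field
    rows cols syms : Fin h → Fin N
    rows-inj : Injective _≡_ _≡_ rows
    cols-inj : Injective _≡_ _≡_ cols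
    syms-inj : Injective _≡_ _≡_ syms
    square : Fin h → Fin h → Fin h
    square-cancellative : Cancellative square
    restrict : ∀ i j → f (rows i) (cols j) ≡ syms (square i j)

record LinkedBlocks {N : ℕ} (f g : Fin N → Fin N → Fin N) (h : ℕ) : Set where
  field
    left  : Block f h
    right : Block g h
    left-syms≗right-rows : Block.syms left ≗ Block.rows right
    right-syms≗left-rows : Block.syms right ≗ Block.rows left

module _ {N : ℕ} where
  open Block
  open LinkedBlocks

  swapLinked : ∀ {f g h} → LinkedBlocks {N} f g h → LinkedBlocks g f h
  swapLinked P = record
    { left = right P ; right = left P
    ; left-syms≗right-rows = right-syms≗left-rows P
    ; right-syms≗left-rows = left-syms≗right-rows P }

  coordinates : ∀ {f g h} → LinkedBlocks {N} f g h → ∀ m → Fin (suc m) → Fin h → Fin N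
  coordinates P zero    _       = rows (left P)
  coordinates P (suc m) zero    = cols (right P)
  coordinates P (suc m) (suc j) = coordinates (swapLinked P) m j

  coordinates-inj : ∀ {f g h} (P : LinkedBlocks {N} f g h) m j →
    Injective _≡_ _≡_ (coordinates P m j)
  coordinates-inj P zero    _       = rows-inj (left P)
  coordinates-inj P (suc m) zero    = cols-inj (right P)
  coordinates-inj P (suc m) (suc j) = coordinates-inj (swapLinked P) m j

  coordinates-disjoint : ∀ {f g h h′} (P : LinkedBlocks {N} f g h) (Q : LinkedBlocks f g h′) →
    DisjointIm (rows (left P)) (rows (left Q)) →
    DisjointIm (rows (right P)) (rows (right Q)) →
    DisjointIm (cols (left P)) (cols (left Q)) →
    DisjointIm (cols (right P)) (cols (right Q)) →
    ∀ m j → DisjointIm (coordinates P m j) (coordinates Q m j)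
  coordinates-disjoint P Q dRl _   _   _   zero    _       = dRl
  coordinates-disjoint P Q _   _   _   dCr (suc m) zero    = dCr
  coordinates-disjoint P Q dRl dRr dCl dCr (suc m) (suc j) =
    coordinates-disjoint (swapLinked P) (swapLinked Q) dRr dRl dCr dCl m j

  alternate-restrict : ∀ {f g h} (P : LinkedBlocks {N} f g h) m (x : Fin (suc m) → Fin h) →
    alternate f g m (λ j → coordinates P m j (x j))
      ≡ rows (left P) (alternate (square (left P)) (square (right P)) m x)
  alternate-restrict P zero    x = refl
  alternate-restrict {f} {g} P (suc m) x = begin
    g (alternate g f m (λ j → coordinates (swapLinked P) m j (tail x j))) (cols (right P) (head x))
      ≡⟨ cong (λ r → g r (cols (right P) (head x))) (alternate-restrict (swapLinked P) m (tail x)) ⟩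
    g (rows (right P) inner) (cols (right P) (head x))
      ≡⟨ restrict (right P) inner (head x) ⟩
    syms (right P) (square (right P) inner (head x))
      ≡⟨ right-syms≗left-rows P _ ⟩
    rows (left P) (square (right P) inner (head x)) ∎
    where
    open ≡-Reasoning
    inner = alternate (square (right P)) (square (left P)) m (tail x)

  subhypercube : ∀ {f g h} (P : LinkedBlocks {N} f g h) m →
    Subhypercube (suc m) N (alternate f g m) h
  subhypercube P m = record
    { idx        = coordinates P m
    ; syms       = rows (left P)
    ; idx-inj    = coordinates-inj P m
    ; syms-inj   = rows-inj (left P)
    ; cube       = alternate (square (left P)) (square (right P)) m
    ; cube-latin = alternate-latin (square-cancellative (left P)) (square-cancellative (right P)) m
    ; restrict   = alternate-restrict P m }

module _ {N : ℕ} {L : Fin N → Fin N → Fin N} (latin : IsLatinSquare N L) where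
  open Subsquare

  subsquare-linkedBlocks : ∀ {h} → Subsquare N L h → LinkedBlocks L (rowConjugate L latin) h
  subsquare-linkedBlocks S = record
    { left = record
      { rows = rows S ; cols = cols S ; syms = syms S
      ; rows-inj = rows-inj S ; cols-inj = cols-inj S ; syms-inj = syms-inj S
      ; square = square S
      ; square-cancellative = latinSquare-cancellative (square S) (square-latin S)
      ; restrict = restrict S }
    ; right = record
      { rows = syms S ; cols = cols S ; syms = rows S
      ; rows-inj = syms-inj S ; cols-inj = cols-inj S ; syms-inj = rows-inj S
      ; square = rowConjugate (square S) (square-latin S)
      ; square-cancellative = rowConjugate-cancellative (square S) (square-latin S)
      ; restrict = λ i j → sym (rowConjugate-unique L latin _ _ _ (begin
          L (rows S (rowConjugate (square S) (square-latin S) i j)) (cols S j)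
            ≡⟨ restrict S _ _ ⟩
          syms S (square S (rowConjugate (square S) (square-latin S) i j) j)
            ≡⟨ cong (syms S) (rowConjugate-spec (square S) (square-latin S) i j) ⟩
          syms S i ∎)) }
    ; left-syms≗right-rows = λ _ → refl
    ; right-syms≗left-rows = λ _ → refl }
    where open ≡-Reasoning

LS⇒RP : ∀ n (h : Fin n → ℕ) → LS n h → ∀ m → RP (suc m) n h
LS⇒RP n h (L , latin , S , disjoint) m =
  alternate L (rowConjugate L latin) m ,
  alternate-latin (latinSquare-cancellative L latin) (rowConjugate-cancellative L latin) m ,
  (λ i → subhypercube (linked i) m) ,
  λ i j i≢j → let (dR , dC , dS) = disjoint i j i≢j in
    coordinates-disjoint (linked i) (linked j) dR dS dC dC m , dR
  where
  linked : ∀ i → LinkedBlocks L (rowConjugate L latin) (h i)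
  linked i = subsquare-linkedBlocks latin (S i)

corollary21 : (n : ℕ) (h : Fin n → ℕ) →
    (∀ i j → i ≤ꟳ j → h j ≤ h i) →
    (∀ i → 0 < h i) →
    LS n h →
    ∀ m → 3 ≤ m → RP m n h
corollary21 n h _ _ ls (suc m) _ = LS⇒RP n h ls m
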